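{- (a) For every non-constant threshold function $f:\{0,1\}^n\to\{0,1\}$ it holds that $NN(f)=2$. (b) If $n$ is odd then $BNN(MAJ_n)=2$, and if $n$ is even then $BNN(MAJ_n)\le \frac n2+2$. (c) $BNN\bigl(TH_n^{\lfloor n/3\rfloor}\bigr)=2^{\Omega(n)}$ (as $n\to\infty$).
   Context: $d$ denotes Euclidean distance in $\mathbb R^n$. A nearest neighbor (NN) representation of $f:\{0,1\}^n\to\{0,1\}$ is a pair of disjoint sets $P,N\subseteq\mathbb R^n$ such that for every $a\in\{0,1\}^n$: if $f(a)=1$ there is $b\in P$ with $d(a,b)<d(a,c)$ for all $c\in N$, and if $f(a)=0$ there is $b\in N$ with $d(a,b)<d(a,c)$ for all $c\in P$. Its size is $|P\cup N|$; $NN(f)$ is the minimum size of an NN representation of $f$. A representation is Boolean if $P\cup N\subseteq\{0,1\}^n$; $BNN(f)$ is the minimum size of a Boolean NN representation. A threshold function is $f$ such that for some $w_1,\dots,w_n,t\in\mathbb R$, $f(x)=1$ iff $w_1x_1+\cdots+w_nx_n\ge t$ for all $x\in\{0,1\}^n$. $TH_n^t$ is the threshold function with $w_1=\dots=w_n=1$ and threshold $t$, i.e. $TH_n^t(x)=1$ iff $\sum_i x_i\ge t$; $MAJ_n=TH_n^{n/2}$.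
   Formalization: In part (a) the weights and threshold of a threshold function are rational instead of real, and the points of NN representations lie in ℚ^n rather than ℝ^n. -}

module Defs where

open import Data.Bool using (Bool; true; false; if_then_else_)
open import Data.Nat as ℕ using (ℕ; _∸_; _/_)
open import Data.Vec using (Vec; []; _∷_; zipWith; foldr)
open import Data.List using (List; length)
open import Data.List.Membership.Propositional using (_∈_; _∉_)
open import Data.List.Relation.Unary.Unique.Propositional using (Unique)
open import Data.Rational as ℚ using (ℚ; 0ℚ; 1ℚ)
open import Data.Product using (Σ; _×_; ∃; ∃-syntax)
open import Function.Bundles using (_⇔_)
open import Relation.Binary.PropositionalEquality using (_≡_; _≢_)

Cube : ℕ → Set
Cube n = Vec Bool n

BoolFn : ℕ → Set
BoolFn n = Cube n → Bool

toℚ : Bool → ℚ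
toℚ b = if b then 1ℚ else 0ℚ

embed : ∀ {n} → Cube n → Vec ℚ n
embed = Data.Vec.map toℚ

sumℚ : ∀ {n} → Vec ℚ n → ℚ
sumℚ = foldr _ ℚ._+_ 0ℚ

-- squared Euclidean distance (comparing d² is the same as comparing d)
dist² : ∀ {n} → Vec ℚ n → Vec ℚ n → ℚ
dist² u v = sumℚ (zipWith (λ a b → (a ℚ.- b) ℚ.* (a ℚ.- b)) u v)

-- NN representation (P, N) of f, with points of type X mapped into ℚ^n by ι.
-- Finite sets are duplicate-free lists; P and N disjoint.
IsNNRepOver : ∀ {n} {X : Set} (ι : X → Vec ℚ n) → BoolFn n → List X → List X → Set
IsNNRepOver {n} ι f P N =
  Unique P × Unique N × (∀ x → x ∈ P → x ∉ N) ×
  (∀ (a : Cube n) → f a ≡ true →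
     ∃[ b ] (b ∈ P × (∀ c → c ∈ N → dist² (embed a) (ι b) ℚ.< dist² (embed a) (ι c)))) ×
  (∀ (a : Cube n) → f a ≡ false →
     ∃[ b ] (b ∈ N × (∀ c → c ∈ P → dist² (embed a) (ι b) ℚ.< dist² (embed a) (ι c))))

HasNNRep : ∀ {n} → BoolFn n → ℕ → Set
HasNNRep {n} f k = ∃[ P ] ∃[ N ] (IsNNRepOver {n} {Vec ℚ n} (λ v → v) f P N × length P ℕ.+ length N ≡ k)

HasBNNRep : ∀ {n} → BoolFn n → ℕ → Set
HasBNNRep {n} f k = ∃[ P ] ∃[ N ] (IsNNRepOver {n} {Cube n} embed f P N × length P ℕ.+ length N ≡ k)

NNis : ∀ {n} → BoolFn n → ℕ → Set
NNis f m = HasNNRep f m × (∀ k → HasNNRep f k → m ℕ.≤ k)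

BNNis : ∀ {n} → BoolFn n → ℕ → Set
BNNis f m = HasBNNRep f m × (∀ k → HasBNNRep f k → m ℕ.≤ k)

IsThreshold : ∀ {n} → BoolFn n → Set
IsThreshold {n} f = ∃[ w ] ∃[ t ]
  (∀ (x : Cube n) → (f x ≡ true) ⇔ (t ℚ.≤ sumℚ (zipWith ℚ._*_ w (embed x))))

NonConstant : ∀ {n} → BoolFn n → Set
NonConstant {n} f = ∃[ x ] ∃[ y ] (f x ≢ f y)

weight : ∀ {n} → Cube n → ℕ
weight [] = 0
weight (true ∷ x) = ℕ.suc (weight x)
weight (false ∷ x) = weight x

TH : (n t : ℕ) → BoolFn n
TH n t x = t ℕ.≤ᵇ weight x

-- MAJ_n = TH_n^{n/2}: Σ x_i ≥ n/2  iff  Σ x_i ≥ ⌈n/2⌉ = (n+1) div 2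
MAJ : (n : ℕ) → BoolFn n
MAJ n = TH n ((ℕ.suc n) / 2)

{-# OPTIONS --safe #-}
-- (a) Let f be x ↦ [w·x ≥ t]. Choose s with max {w·a : f a = 0} < s < t and a point c
-- with w·c = s; the two points c ± w represent f, because
-- |u − (c − w)|² − |u − (c + w)|² = 4 (w·u − s).
-- (b) On the cube, squared distance is Hamming distance. For n = 2k + 1 the points 1ⁿ
-- and 0ⁿ represent MAJ, as d(a, 0ⁿ) = |a| and d(a, 1ⁿ) = n − |a|. For n = 2k take
-- N = {0ⁿ} and for P the k + 1 points of weight n − 1 whose zero is among the first
-- k + 1 coordinates: an input of weight k has a zero there, and is at distance k − 1
-- from the corresponding point of P.
-- (c) In a Boolean representation of TH_n^t let b be the nearest positive point to an
-- input a of weight t. Switching off a one of a gives a negative input; if b disagreed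
-- with a there, b would be nearer to that input than every negative point. So b ⊇ a,
-- and likewise the nearest negative point to a − e_i lies inside a − e_i, which gives
-- d(a, b) < t and |b| < 2t. Now take the 3^t inputs with one 1 in each of t blocks of
-- three coordinates: a block holding s ones of b allows s choices and 2s ≤ 2^s, so b
-- contains at most 2^|b| / 2^t ≤ 2^t of them. Hence |P| ≥ (3/2)^t, and 2^n ≤ |P|^12
-- since n ≤ 3t + 2.
module Submission where

open import Defs
open import Data.Bool using (Bool; true; false; not; _xor_; _∧_; if_then_else_)
open import Data.Bool.Properties using (xor-comm; T-≡; ¬-not)
open import Data.Empty using (⊥-elim)
open import Data.Fin using (Fin)
open import Data.Fin.Subset using (_⊆_; Nonempty)
open import Data.Fin.Subset.Properties using (drop-∷-⊆; _⊆?_)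
open import Data.List using (List; []; _∷_; [_]; _++_; map; concatMap; filter; length)
open import Data.List.Membership.Propositional using (_∈_; _∉_; lose)
open import Data.List.Membership.Propositional.Properties
  using (∈-length; ∈-map⁺; ∈-map⁻; ∈-++⁺ˡ; ∈-++⁺ʳ; ∈-filter⁺; ∈-filter⁻)
open import Data.List.Properties using (length-map; length-++; length-filter; filter-++; filter-accept)
open import Data.List.Relation.Unary.All as All using (All; []; _∷_)
import Data.List.Relation.Unary.All.Properties as All
open import Data.List.Relation.Unary.AllPairs using ([]; _∷_)
open import Data.List.Relation.Unary.Any as Any using (Any; here; there)
open import Data.List.Relation.Unary.Unique.Propositional using (Unique)
import Data.List.Relation.Unary.Unique.Propositional.Properties as Unique
open import Data.Nat using (ℕ; zero; suc; _+_; _*_; _^_; _≤_; _<_; _≤?_; _<?_; _/_; _%_; z≤n; s≤s; s≤s⁻¹)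
open import Data.Nat.DivMod using (m/n≡1+[m∸n]/n; m*n/n≡m; m≡m%n+[m/n]*n; m%n<n; m≥n⇒m/n>0)
open import Data.Nat.ListAction using (sum)
open import Data.Nat.Properties
import Data.Nat.Solver as ℕ-Solver
open import Data.Product using (_×_; _,_; ∃-syntax; proj₁; proj₂)
open import Data.Rational as ℚ using (ℚ; 0ℚ; 1ℚ)
import Data.Rational.Properties as ℚ
import Data.Rational.Solver as ℚ-Solver
open import Data.Sum using (_⊎_; inj₁; inj₂)
open import Data.Vec as Vec using (Vec; []; _∷_; replicate; zipWith; _[_]=_; here; there; _[_]≔_)
open import Data.Vec.Properties using (zipWith-comm; ∷-injectiveʳ; []=-injective)
open import Function using (_∘_)
open import Function.Bundles using (Equivalence; _⇔_)
open import Relation.Binary.Bundles using (DecTotalOrder)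
open import Relation.Binary.PropositionalEquality
  using (_≡_; refl; sym; trans; cong; cong₂; subst; subst₂; module ≡-Reasoning)
open import Relation.Nullary using (¬_; yes; no; does)
open import Relation.Unary using (Decidable)

import Data.List.Extrema (DecTotalOrder.totalOrder ℚ.≤-decTotalOrder) as Extrema

private variable n : ℕ

true≢false : ¬ true ≡ false
true≢false ()

-- Weight and threshold functions

zeros ones : ∀ n → Cube n
zeros n = replicate n false
ones n = replicate n true

weight-zeros : ∀ n → weight (zeros n) ≡ 0
weight-zeros zero = refl
weight-zeros (suc n) = weight-zeros n

weight-ones : ∀ n → weight (ones n) ≡ n
weight-ones zero = refl
weight-ones (suc n) = cong suc (weight-ones n)

weight-++ : ∀ {k} (d : Cube k) (b : Cube n) → weight (d Vec.++ b) ≡ weight d + weight b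
weight-++ [] b = refl
weight-++ (true ∷ d) b = cong suc (weight-++ d b)
weight-++ (false ∷ d) b = weight-++ d b

weight-clear : {x : Cube n} {i : Fin n} → x [ i ]= true → suc (weight (x [ i ]≔ false)) ≡ weight x
weight-clear here = refl
weight-clear {x = true ∷ x} (there x[i]=1) = cong suc (weight-clear x[i]=1)
weight-clear {x = false ∷ x} (there x[i]=1) = weight-clear x[i]=1

weight-set : {x : Cube n} {i : Fin n} → x [ i ]= false → weight (x [ i ]≔ true) ≡ suc (weight x)
weight-set here = refl
weight-set {x = true ∷ x} (there x[i]=0) = cong suc (weight-set x[i]=0)
weight-set {x = false ∷ x} (there x[i]=0) = weight-set x[i]=0

weight>0⇒nonempty : (a : Cube n) → 1 ≤ weight a → Nonempty a
weight>0⇒nonempty (true ∷ a) _ = Fin.zero , here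
weight>0⇒nonempty (false ∷ a) w>0 with weight>0⇒nonempty a w>0
... | i , i∈a = Fin.suc i , there i∈a

[]=-dichotomy : (y : Cube n) (i : Fin n) (u : Bool) → y [ i ]= u ⊎ y [ i ]= not u
[]=-dichotomy (true ∷ y) Fin.zero true = inj₁ here
[]=-dichotomy (true ∷ y) Fin.zero false = inj₂ here
[]=-dichotomy (false ∷ y) Fin.zero true = inj₂ here
[]=-dichotomy (false ∷ y) Fin.zero false = inj₁ here
[]=-dichotomy (_ ∷ y) (Fin.suc i) u with []=-dichotomy y i u
... | inj₁ y[i]=u = inj₁ (there y[i]=u)
... | inj₂ y[i]=¬u = inj₂ (there y[i]=¬u)

TH≡true⇒ : ∀ {t} (a : Cube n) → TH n t a ≡ true → t ≤ weight a
TH≡true⇒ {t = t} a e = ≤ᵇ⇒≤ t (weight a) (Equivalence.from T-≡ e)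

≤⇒TH≡true : ∀ {t} (a : Cube n) → t ≤ weight a → TH n t a ≡ true
≤⇒TH≡true a t≤w = Equivalence.to T-≡ (≤⇒≤ᵇ t≤w)

TH≡false⇒ : ∀ {t} (a : Cube n) → TH n t a ≡ false → weight a < t
TH≡false⇒ a e = ≰⇒> λ t≤w → true≢false (trans (sym (≤⇒TH≡true a t≤w)) e)

<⇒TH≡false : ∀ {t} (a : Cube n) → weight a < t → TH n t a ≡ false
<⇒TH≡false a w<t = ¬-not λ e → <⇒≱ w<t (TH≡true⇒ a e)

TH-nonConstant : ∀ {t} → 0 < t → t ≤ n → NonConstant (TH n t)
TH-nonConstant {n} {t} 0<t t≤n = ones n , zeros n , λ eq → true≢false
  (trans (sym (≤⇒TH≡true (ones n) (subst (t ≤_) (sym (weight-ones n)) t≤n)))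
  (trans eq (<⇒TH≡false (zeros n) (subst (_< t) (sym (weight-zeros n)) 0<t))))

nonConstant⇒values : {f : BoolFn n} → NonConstant f → (∃[ a ] f a ≡ true) × (∃[ a ] f a ≡ false)
nonConstant⇒values {f = f} (x , y , fx≢fy) with f x in fx | f y in fy
... | true  | true  = ⊥-elim (fx≢fy refl)
... | false | false = ⊥-elim (fx≢fy refl)
... | true  | false = (x , fx) , (y , fy)
... | false | true  = (y , fy) , (x , fx)

size≥2 : {X : Set} {ι : X → Vec ℚ n} {f : BoolFn n} {P N : List X} →
         IsNNRepOver ι f P N → NonConstant f → 2 ≤ length P + length N
size≥2 (_ , _ , _ , pos , neg) nonConst with nonConstant⇒values nonConst
... | (a , fa) , (b , fb) with pos a fa | neg b fb
...   | (_ , p∈P , _) | (_ , q∈N , _) = +-mono-≤ (∈-length p∈P) (∈-length q∈N)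

-- Two-point representations of threshold functions

fromℕ : ℕ → ℚ
fromℕ zero = 0ℚ
fromℕ (suc k) = 1ℚ ℚ.+ fromℕ k

allCube : ∀ n → List (Cube n)
allCube zero = [ [] ]
allCube (suc n) = map (true ∷_) (allCube n) ++ map (false ∷_) (allCube n)

∈-allCube : (a : Cube n) → a ∈ allCube n
∈-allCube [] = here refl
∈-allCube (true ∷ a) = ∈-++⁺ˡ (∈-map⁺ (true ∷_) (∈-allCube a))
∈-allCube {suc n} (false ∷ a) = ∈-++⁺ʳ (map (true ∷_) (allCube n)) (∈-map⁺ (false ∷_) (∈-allCube a))

max-below : (g : Cube n → ℚ) (t : ℚ) → ∃[ a ] g a ℚ.< t →
            ∃[ M ] (M ℚ.< t × ∀ a → g a ℚ.< t → g a ℚ.≤ M)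
max-below {n} g t (a₀ , ga₀<t) = M , M<t , λ a ga<t →
  All.lookup (Extrema.xs≤max (g a₀) below) (∈-filter⁺ (ℚ._<? t) (∈-map⁺ g (∈-allCube a)) ga<t)
  where
  below = filter (ℚ._<? t) (map g (allCube n))
  M = Extrema.max (g a₀) below
  M<t : M ℚ.< t
  M<t = Extrema.argmax-all (λ x → x) ga₀<t (All.all-filter (ℚ._<? t) (map g (allCube n)))

gap-below : (g : Cube n → ℚ) (t : ℚ) → ∃[ a ] g a ℚ.< t →
            ∃[ s ] (s ℚ.< t × ∀ a → g a ℚ.< t → g a ℚ.< s)
gap-below g t some-below =
  let (M , M<t , ≤M) = max-below g t some-below
      (s , M<s , s<t) = ℚ.<-dense M<t
  in s , s<t , λ a ga<t → ℚ.≤-<-trans (≤M a ga<t) M<s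

infix 7 _·_
_·_ : Vec ℚ n → Vec ℚ n → ℚ
u · v = sumℚ (zipWith ℚ._*_ u v)

dist²-reflect : (u c w : Vec ℚ n) →
  dist² u (zipWith ℚ._-_ c w) ≡ dist² u (zipWith ℚ._+_ c w) ℚ.+ (w · u ℚ.- w · c) ℚ.* fromℕ 4
dist²-reflect [] [] [] = refl
dist²-reflect (x ∷ u) (y ∷ c) (z ∷ w) =
  trans (cong ((x ℚ.- (y ℚ.- z)) ℚ.* (x ℚ.- (y ℚ.- z)) ℚ.+_) (dist²-reflect u c w))
  (solve 6 (λ x y z D₊ U C →
      (x :- (y :- z)) :* (x :- (y :- z)) :+ (D₊ :+ (U :- C) :* con (fromℕ 4))
   := (x :- (y :+ z)) :* (x :- (y :+ z)) :+ D₊ :+ ((z :* x :+ U) :- (z :* y :+ C)) :* con (fromℕ 4))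
   refl x y z (dist² u (zipWith ℚ._+_ c w)) (w · u) (w · c))
  where open ℚ-Solver.+-*-Solver

·-scaled-difference : (w u v : Vec ℚ n) (μ : ℚ) →
                      w · zipWith (λ x y → μ ℚ.* (x ℚ.- y)) u v ≡ μ ℚ.* (w · u ℚ.- w · v)
·-scaled-difference [] [] [] μ = sym (ℚ.*-zeroʳ μ)
·-scaled-difference (z ∷ w) (x ∷ u) (y ∷ v) μ =
  trans (cong (z ℚ.* (μ ℚ.* (x ℚ.- y)) ℚ.+_) (·-scaled-difference w u v μ))
  (solve 6 (λ z x y μ U V → z :* (μ :* (x :- y)) :+ μ :* (U :- V) := μ :* ((z :* x :+ U) :- (z :* y :+ V)))
   refl z x y μ (w · u) (w · v))
  where open ℚ-Solver.+-*-Solver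

closer-to-sum : (u c w : Vec ℚ n) → w · c ℚ.< w · u →
                dist² u (zipWith ℚ._+_ c w) ℚ.< dist² u (zipWith ℚ._-_ c w)
closer-to-sum u c w lt = begin-strict
  d₊                                           ≡⟨ ℚ.+-identityʳ d₊ ⟨
  d₊ ℚ.+ 0ℚ                                    <⟨ ℚ.+-monoʳ-< d₊ (ℚ.*-monoˡ-<-pos (fromℕ 4) 0<δ) ⟩
  d₊ ℚ.+ (w · u ℚ.- w · c) ℚ.* fromℕ 4         ≡⟨ dist²-reflect u c w ⟨
  dist² u (zipWith ℚ._-_ c w)                  ∎
  where
  open ℚ.≤-Reasoning
  d₊ = dist² u (zipWith ℚ._+_ c w)
  0<δ : 0ℚ ℚ.< w · u ℚ.- w · c
  0<δ = subst (ℚ._< w · u ℚ.- w · c) (ℚ.+-inverseʳ (w · c)) (ℚ.+-monoˡ-< (ℚ.- (w · c)) lt)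

closer-to-difference : (u c w : Vec ℚ n) → w · u ℚ.< w · c →
                       dist² u (zipWith ℚ._-_ c w) ℚ.< dist² u (zipWith ℚ._+_ c w)
closer-to-difference u c w lt = begin-strict
  dist² u (zipWith ℚ._-_ c w)                  ≡⟨ dist²-reflect u c w ⟩
  d₊ ℚ.+ (w · u ℚ.- w · c) ℚ.* fromℕ 4         <⟨ ℚ.+-monoʳ-< d₊ (ℚ.*-monoˡ-<-pos (fromℕ 4) δ<0) ⟩
  d₊ ℚ.+ 0ℚ                                    ≡⟨ ℚ.+-identityʳ d₊ ⟩
  d₊                                           ∎
  where
  open ℚ.≤-Reasoning
  d₊ = dist² u (zipWith ℚ._+_ c w)
  δ<0 : w · u ℚ.- w · c ℚ.< 0ℚ
  δ<0 = subst (w · u ℚ.- w · c ℚ.<_) (ℚ.+-inverseʳ (w · c)) (ℚ.+-monoˡ-< (ℚ.- (w · c)) lt)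

two-point-rep : {f : BoolFn n} {p q : Vec ℚ n} → ∃[ a ] f a ≡ true →
  (∀ a → f a ≡ true → dist² (embed a) p ℚ.< dist² (embed a) q) →
  (∀ a → f a ≡ false → dist² (embed a) q ℚ.< dist² (embed a) p) →
  IsNNRepOver (λ v → v) f [ p ] [ q ]
two-point-rep {p = p} {q} (a₀ , fa₀) closer-p closer-q =
  All.[] ∷ [] , All.[] ∷ [] , disjoint ,
  (λ a fa → p , here refl , λ { _ (here refl) → closer-p a fa }) ,
  (λ a fa → q , here refl , λ { _ (here refl) → closer-q a fa })
  where
  disjoint : ∀ x → x ∈ [ p ] → x ∉ [ q ]
  disjoint _ (here refl) (here p≡q) = ℚ.<-irrefl (cong (dist² (embed a₀)) p≡q) (closer-p a₀ fa₀)

below-threshold : {f : BoolFn n} {g : Cube n → ℚ} {t : ℚ} → (∀ x → (f x ≡ true) ⇔ (t ℚ.≤ g x)) →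
                  ∀ {a} → f a ≡ false → g a ℚ.< t
below-threshold f⇔ {a} fa = ℚ.≰⇒> λ t≤ga → true≢false (trans (sym (Equivalence.from (f⇔ a) t≤ga)) fa)

threshold-separator : {f : BoolFn n} → IsThreshold f → ∃[ a ] f a ≡ true → ∃[ a ] f a ≡ false →
  ∃[ w ] ∃[ c ] ((∀ a → f a ≡ true → w · c ℚ.< w · embed a) ×
                 (∀ a → f a ≡ false → w · embed a ℚ.< w · c))
threshold-separator (w , t , f⇔) (aT , faT) (aF , faF)
  with gap-below (λ a → w · embed a) t (aF , below-threshold f⇔ faF)
... | s , s<t , below-s = w , c ,
  (λ a fa → subst (ℚ._< w · embed a) (sym w·c≡s) (ℚ.<-≤-trans s<t (Equivalence.to (f⇔ a) fa))) ,
  (λ a fa → subst (w · embed a ℚ.<_) (sym w·c≡s) (below-s a (below-threshold f⇔ fa)))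
  where
  D = w · embed aT ℚ.- w · embed aF
  0<D : 0ℚ ℚ.< D
  0<D = subst (ℚ._< D) (ℚ.+-inverseʳ (w · embed aF)) (ℚ.+-monoˡ-< (ℚ.- (w · embed aF))
          (ℚ.<-≤-trans (below-threshold f⇔ faF) (Equivalence.to (f⇔ aT) faT)))
  instance
    D≢0 : ℚ.NonZero D
    D≢0 = ℚ.>-nonZero 0<D
  c = zipWith (λ x y → (s ℚ.* ℚ.1/ D) ℚ.* (x ℚ.- y)) (embed aT) (embed aF)
  w·c≡s : w · c ≡ s
  w·c≡s = begin
    w · c                    ≡⟨ ·-scaled-difference w (embed aT) (embed aF) (s ℚ.* ℚ.1/ D) ⟩
    (s ℚ.* ℚ.1/ D) ℚ.* D     ≡⟨ ℚ.*-assoc s (ℚ.1/ D) D ⟩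
    s ℚ.* (ℚ.1/ D ℚ.* D)     ≡⟨ cong (s ℚ.*_) (ℚ.*-inverseˡ D) ⟩
    s ℚ.* 1ℚ                 ≡⟨ ℚ.*-identityʳ s ⟩
    s                        ∎
    where open ≡-Reasoning

separator-rep : {f : BoolFn n} (w c : Vec ℚ n) → ∃[ a ] f a ≡ true →
  (∀ a → f a ≡ true → w · c ℚ.< w · embed a) → (∀ a → f a ≡ false → w · embed a ℚ.< w · c) → HasNNRep f 2
separator-rep w c true-point above below = [ zipWith ℚ._+_ c w ] , [ zipWith ℚ._-_ c w ] ,
  two-point-rep true-point (λ a fa → closer-to-sum (embed a) c w (above a fa))
                           (λ a fa → closer-to-difference (embed a) c w (below a fa)) , refl

-- `let` rather than `with`: with-abstraction over the separator is very slow to type-check.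
threshold-NN : {f : BoolFn n} → IsThreshold f → NonConstant f → NNis f 2
threshold-NN thr nonConst =
  let (true-point , false-point) = nonConstant⇒values nonConst
      (w , c , above , below) = threshold-separator thr true-point false-point
  in separator-rep w c true-point above below , λ k (_ , _ , rep , size) → subst (2 ≤_) size (size≥2 rep nonConst)

-- Hamming distance

hamming : Cube n → Cube n → ℕ
hamming a b = weight (zipWith _xor_ a b)

hamming-self : (a : Cube n) → hamming a a ≡ 0
hamming-self [] = refl
hamming-self (true ∷ a) = hamming-self a
hamming-self (false ∷ a) = hamming-self a

hamming-sym : (a b : Cube n) → hamming a b ≡ hamming b a
hamming-sym a b = cong weight (zipWith-comm xor-comm a b)

hamming-zeros : (a : Cube n) → hamming a (zeros n) ≡ weight a
hamming-zeros [] = refl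
hamming-zeros (true ∷ a) = cong suc (hamming-zeros a)
hamming-zeros (false ∷ a) = hamming-zeros a

hamming-ones : (a : Cube n) → hamming a (ones n) + weight a ≡ n
hamming-ones [] = refl
hamming-ones (true ∷ a) = trans (+-suc _ (weight a)) (cong suc (hamming-ones a))
hamming-ones (false ∷ a) = cong suc (hamming-ones a)

weight≤hamming+weight : (a b : Cube n) → weight b ≤ hamming a b + weight a
weight≤hamming+weight [] [] = z≤n
weight≤hamming+weight (true ∷ a) (true ∷ b) =
  ≤-trans (s≤s (weight≤hamming+weight a b)) (≤-reflexive (sym (+-suc _ (weight a))))
weight≤hamming+weight (true ∷ a) (false ∷ b) =
  ≤-trans (weight≤hamming+weight a b) (+-mono-≤ (n≤1+n _) (n≤1+n _))
weight≤hamming+weight (false ∷ a) (true ∷ b) = s≤s (weight≤hamming+weight a b)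
weight≤hamming+weight (false ∷ a) (false ∷ b) = weight≤hamming+weight a b

hamming-update-≤ : (x : Cube n) (i : Fin n) (v : Bool) (y : Cube n) →
                   hamming x y ≤ suc (hamming (x [ i ]≔ v) y)
hamming-update-≤ (u ∷ x) Fin.zero v (w ∷ y) with u xor w | v xor w
... | true  | true  = n≤1+n _
... | true  | false = ≤-refl
... | false | true  = ≤-trans (n≤1+n _) (n≤1+n _)
... | false | false = n≤1+n _
hamming-update-≤ (u ∷ x) (Fin.suc i) v (w ∷ y) with u xor w
... | true  = s≤s (hamming-update-≤ x i v y)
... | false = hamming-update-≤ x i v y

hamming-update-agree : {x y : Cube n} {i : Fin n} {u : Bool} → x [ i ]= u → y [ i ]= not u →
                       suc (hamming (x [ i ]≔ not u) y) ≡ hamming x y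
hamming-update-agree {u = true} here here = refl
hamming-update-agree {u = false} here here = refl
hamming-update-agree {x = v ∷ x} {w ∷ y} (there x[i]=u) (there y[i]=¬u) with v xor w
... | true  = cong suc (hamming-update-agree x[i]=u y[i]=¬u)
... | false = hamming-update-agree x[i]=u y[i]=¬u

-- Cube n is Subset n, so _⊆_ is the subset order of Data.Fin.Subset.
⊆⇒hamming≤weight : {c : Cube n} (x : Cube n) → c ⊆ x → hamming x c ≤ weight x
⊆⇒hamming≤weight {c = []} [] c⊆x = z≤n
⊆⇒hamming≤weight {c = true ∷ c} (true ∷ x) c⊆x = m≤n⇒m≤1+n (⊆⇒hamming≤weight x (drop-∷-⊆ c⊆x))
⊆⇒hamming≤weight {c = false ∷ c} (true ∷ x) c⊆x = s≤s (⊆⇒hamming≤weight x (drop-∷-⊆ c⊆x))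
⊆⇒hamming≤weight {c = true ∷ c} (false ∷ x) c⊆x with c⊆x here
... | ()
⊆⇒hamming≤weight {c = false ∷ c} (false ∷ x) c⊆x = ⊆⇒hamming≤weight x (drop-∷-⊆ c⊆x)

fromℕ-<-suc : ∀ k → fromℕ k ℚ.< fromℕ (suc k)
fromℕ-<-suc k = subst (ℚ._< fromℕ (suc k)) (ℚ.+-identityˡ (fromℕ k)) (ℚ.+-monoˡ-< (fromℕ k) (ℚ.positive⁻¹ 1ℚ))

fromℕ-mono-< : ∀ {j k} → j < k → fromℕ j ℚ.< fromℕ k
fromℕ-mono-< {j} {suc k} (s≤s j≤k) with m≤n⇒m<n∨m≡n j≤k
... | inj₁ j<k = ℚ.<-trans (fromℕ-mono-< j<k) (fromℕ-<-suc k)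
... | inj₂ refl = fromℕ-<-suc k

fromℕ-cancel-< : ∀ {j k} → fromℕ j ℚ.< fromℕ k → j < k
fromℕ-cancel-< {j} {k} q with j <? k
... | yes j<k = j<k
... | no j≮k with m≤n⇒m<n∨m≡n (≮⇒≥ j≮k)
...   | inj₁ k<j = ⊥-elim (ℚ.<-asym q (fromℕ-mono-< k<j))
...   | inj₂ refl = ⊥-elim (ℚ.<-irrefl refl q)

dist²-embed : (a b : Cube n) → dist² (embed a) (embed b) ≡ fromℕ (hamming a b)
dist²-embed [] [] = refl
dist²-embed (true ∷ a) (true ∷ b) = trans (ℚ.+-identityˡ _) (dist²-embed a b)
dist²-embed (true ∷ a) (false ∷ b) = cong (1ℚ ℚ.+_) (dist²-embed a b)
dist²-embed (false ∷ a) (true ∷ b) = cong (1ℚ ℚ.+_) (dist²-embed a b)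
dist²-embed (false ∷ a) (false ∷ b) = trans (ℚ.+-identityˡ _) (dist²-embed a b)

Closer : Cube n → Cube n → List (Cube n) → Set
Closer a b C = ∀ c → c ∈ C → hamming a b < hamming a c

HasCloser : Cube n → List (Cube n) → List (Cube n) → Set
HasCloser a B C = ∃[ b ] (b ∈ B × Closer a b C)

IsHammingRep : BoolFn n → List (Cube n) → List (Cube n) → Set
IsHammingRep {n} f P N = (∀ (a : Cube n) → f a ≡ true → HasCloser a P N)
                       × (∀ (a : Cube n) → f a ≡ false → HasCloser a N P)

HasCloser⇒∉ : {a : Cube n} {B C : List (Cube n)} → HasCloser a B C → a ∉ C
HasCloser⇒∉ {a = a} (b , _ , closer) a∈C = n≮0 (subst (hamming a b <_) (hamming-self a) (closer a a∈C))

isNNRep⇒isHammingRep : {f : BoolFn n} {P N : List (Cube n)} → IsNNRepOver embed f P N → IsHammingRep f P N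
isNNRep⇒isHammingRep (_ , _ , _ , pos , neg) = (λ a fa → toHamming {a} (pos a fa)) , (λ a fa → toHamming {a} (neg a fa))
  where
  toHamming : ∀ {a B C} →
              ∃[ b ] (b ∈ B × ∀ c → c ∈ C → dist² (embed a) (embed b) ℚ.< dist² (embed a) (embed c)) →
              HasCloser a B C
  toHamming {a} (b , b∈B , closer) = b , b∈B , λ c c∈C →
    fromℕ-cancel-< (subst₂ ℚ._<_ (dist²-embed a b) (dist²-embed a c) (closer c c∈C))

isHammingRep⇒isNNRep : {f : BoolFn n} {P N : List (Cube n)} → Unique P → Unique N →
                       IsHammingRep f P N → IsNNRepOver embed f P N
isHammingRep⇒isNNRep {f = f} {P} {N} uniqueP uniqueN (pos , neg) =
  uniqueP , uniqueN , disjoint , (λ a fa → fromHamming {a} (pos a fa)) , (λ a fa → fromHamming {a} (neg a fa))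
  where
  disjoint : ∀ x → x ∈ P → x ∉ N
  disjoint x x∈P with f x in fx
  ... | true = HasCloser⇒∉ (pos x fx)
  ... | false = λ _ → HasCloser⇒∉ (neg x fx) x∈P
  fromHamming : ∀ {a B C} → HasCloser a B C →
                ∃[ b ] (b ∈ B × ∀ c → c ∈ C → dist² (embed a) (embed b) ℚ.< dist² (embed a) (embed c))
  fromHamming {a} (b , b∈B , closer) = b , b∈B , λ c c∈C →
    subst₂ ℚ._<_ (sym (dist²-embed a b)) (sym (dist²-embed a c)) (fromℕ-mono-< (closer c c∈C))

-- Majority

2*n≡n+n : ∀ n → 2 * n ≡ n + n
2*n≡n+n n = cong (n +_) (+-identityʳ n)

m+n≤2*n⇒m≤n : ∀ {m n} → m + n ≤ 2 * n → m ≤ n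
m+n≤2*n⇒m≤n {m} {n} le = +-cancelʳ-≤ n m n (subst (m + n ≤_) (2*n≡n+n n) le)

2*n<m+n⇒n<m : ∀ {m n} → 2 * n < m + n → n < m
2*n<m+n⇒n<m {m} {n} lt = +-cancelʳ-< n n m (subst (_< m + n) (2*n≡n+n n) lt)

m<n⇒2+2*m≤2*n : ∀ {m n} → m < n → suc (suc (2 * m)) ≤ 2 * n
m<n⇒2+2*m≤2*n {m} {n} m<n = subst (_≤ 2 * n) (*-suc 2 m) (*-monoʳ-≤ 2 m<n)

2+j≤2*[1+j] : ∀ j → suc (suc j) ≤ 2 * suc j
2+j≤2*[1+j] j = subst (suc (suc j) ≤_) (sym (*-suc 2 j)) (s≤s (s≤s (m≤n*m j 2)))

[2+2*k]/2≡1+k : ∀ k → suc (suc (2 * k)) / 2 ≡ suc k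
[2+2*k]/2≡1+k k = trans (m/n≡1+[m∸n]/n {suc (suc (2 * k))} (s≤s (s≤s z≤n)))
                        (cong suc (trans (cong (_/ 2) (*-comm 2 k)) (m*n/n≡m k 2)))

[1+2*k]/2≡k : ∀ k → suc (2 * k) / 2 ≡ k
[1+2*k]/2≡k zero = refl
[1+2*k]/2≡k (suc k) = begin-equality
  suc (2 * suc k) / 2         ≡⟨ cong (λ m → suc m / 2) (*-suc 2 k) ⟩
  suc (suc (suc (2 * k))) / 2 ≡⟨ m/n≡1+[m∸n]/n {suc (suc (suc (2 * k)))} (s≤s (s≤s z≤n)) ⟩
  suc (suc (2 * k) / 2)       ≡⟨ cong suc ([1+2*k]/2≡k k) ⟩
  suc k                       ∎
  where open ≤-Reasoning

MAJ-odd-rep : ∀ k → IsNNRepOver embed (MAJ (suc (2 * k))) [ ones (suc (2 * k)) ] [ zeros (suc (2 * k)) ]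
MAJ-odd-rep k = isHammingRep⇒isNNRep (All.[] ∷ []) (All.[] ∷ []) (pos , neg)
  where
  open ≤-Reasoning
  pos : ∀ a → MAJ _ a ≡ true → HasCloser a _ _
  pos a maj = ones _ , here refl , λ { _ (here refl) →
    subst (hamming a (ones _) <_) (sym (hamming-zeros a)) (m+n≤2*n⇒m≤n (begin
    suc (hamming a (ones _)) + weight a ≡⟨ cong suc (hamming-ones a) ⟩
    suc (suc (2 * k))                  ≤⟨ m<n⇒2+2*m≤2*n (subst (_≤ weight a) ([2+2*k]/2≡1+k k) (TH≡true⇒ a maj)) ⟩
    2 * weight a                       ∎)) }
  neg : ∀ a → MAJ _ a ≡ false → HasCloser a _ _
  neg a maj = zeros _ , here refl , λ { _ (here refl) →
    subst (_< hamming a (ones _)) (sym (hamming-zeros a)) (2*n<m+n⇒n<m (begin-strict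
    2 * weight a                  ≤⟨ *-monoʳ-≤ 2 (s≤s⁻¹ (subst (weight a <_) ([2+2*k]/2≡1+k k)
                                                         (TH≡false⇒ a maj))) ⟩
    2 * k                         <⟨ n<1+n _ ⟩
    suc (2 * k)                   ≡⟨ hamming-ones a ⟨
    hamming a (ones _) + weight a ∎)) }

MAJ-odd-BNN : ∀ k → BNNis (MAJ (suc (2 * k))) 2
MAJ-odd-BNN k = (_ , _ , MAJ-odd-rep k , refl) , λ m (_ , _ , rep , size) → subst (2 ≤_) size (size≥2 rep nonConst)
  where
  nonConst : NonConstant (MAJ (suc (2 * k)))
  nonConst = TH-nonConstant (subst (0 <_) (sym ([2+2*k]/2≡1+k k)) (s≤s z≤n))
                            (subst (_≤ suc (2 * k)) (sym ([2+2*k]/2≡1+k k)) (s≤s (m≤n*m k 2)))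

holes : (n m : ℕ) → List (Cube n)
holes zero m = []
holes (suc n) zero = []
holes (suc n) (suc m) = (false ∷ ones n) ∷ map (true ∷_) (holes n m)

holes-unique : ∀ n m → Unique (holes n m)
holes-unique zero m = []
holes-unique (suc n) zero = []
holes-unique (suc n) (suc m) =
  All.map⁺ (All.universal (λ _ ()) (holes n m)) ∷ Unique.map⁺ ∷-injectiveʳ (holes-unique n m)

holes-length : ∀ {n m} → m ≤ n → length (holes n m) ≡ m
holes-length {zero} z≤n = refl
holes-length {suc n} z≤n = refl
holes-length {suc n} (s≤s m≤n) = cong suc (trans (length-map _ (holes n _)) (holes-length m≤n))

holes-weight : ∀ {n m p} → p ∈ holes n m → suc (weight p) ≡ n
holes-weight {suc n} {suc m} (here refl) = cong suc (weight-ones n)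
holes-weight {suc n} {suc m} (there p∈) with ∈-map⁻ (true ∷_) p∈
... | q , q∈ , refl = cong suc (holes-weight q∈)

holes-closer : ∀ {n m} (a : Cube n) → m ≤ n → weight a < m →
               ∃[ p ] (p ∈ holes n m × suc (hamming a p) ≡ hamming a (ones n))
holes-closer {suc n} {suc m} (false ∷ a) _ _ = false ∷ ones n , here refl , refl
holes-closer {suc n} {suc m} (true ∷ a) (s≤s m≤n) (s≤s w<m) with holes-closer a m≤n w<m
... | p , p∈ , eq = true ∷ p , there (∈-map⁺ (true ∷_) p∈) , eq

MAJ-even-rep : ∀ j → IsNNRepOver embed (MAJ (2 * suc j)) (holes (2 * suc j) (suc (suc j))) [ zeros (2 * suc j) ]
MAJ-even-rep j = isHammingRep⇒isNNRep (holes-unique 2k (suc k)) (All.[] ∷ []) (pos , neg)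
  where
  open ≤-Reasoning
  k = suc j
  2k = 2 * k
  threshold : suc 2k / 2 ≡ k
  threshold = [1+2*k]/2≡k k
  pos : ∀ a → MAJ 2k a ≡ true → HasCloser a (holes 2k (suc k)) [ zeros 2k ]
  pos a maj with m≤n⇒m<n∨m≡n (subst (_≤ weight a) threshold (TH≡true⇒ a maj))
  ... | inj₁ k<w = false ∷ ones _ , here refl , λ { _ (here refl) →
    subst (hamming a (false ∷ ones _) <_) (sym (hamming-zeros a)) (begin-strict
      hamming a (false ∷ ones _)       ≡⟨ hamming-sym a _ ⟩
      hamming (false ∷ ones _) a       <⟨ s≤s (hamming-update-≤ (false ∷ ones _) Fin.zero true a) ⟩
      suc (suc (hamming (ones 2k) a))  ≡⟨ cong (suc ∘ suc) (hamming-sym (ones 2k) a) ⟩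
      suc (suc (hamming a (ones 2k)))  ≤⟨ m+n≤2*n⇒m≤n (begin
        suc (suc (hamming a (ones 2k))) + weight a ≡⟨ cong (suc ∘ suc) (hamming-ones a) ⟩
        suc (suc 2k)                                ≤⟨ m<n⇒2+2*m≤2*n k<w ⟩
        2 * weight a                                ∎) ⟩
      weight a                         ∎) }
  ... | inj₂ k≡w with holes-closer a (2+j≤2*[1+j] j) (s≤s (≤-reflexive (sym k≡w)))
  ...   | p , p∈ , eq = p , p∈ , λ { _ (here refl) → subst (hamming a p <_) (sym (hamming-zeros a)) (m+n≤2*n⇒m≤n (begin
    suc (hamming a p) + weight a   ≡⟨ cong (_+ weight a) eq ⟩
    hamming a (ones 2k) + weight a ≡⟨ hamming-ones a ⟩
    2k                             ≡⟨ cong (2 *_) k≡w ⟩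
    2 * weight a                   ∎)) }
  neg : ∀ a → MAJ 2k a ≡ false → HasCloser a [ zeros 2k ] (holes 2k (suc k))
  neg a maj = zeros 2k , here refl , λ c c∈ → subst (_< hamming a c) (sym (hamming-zeros a)) (2*n<m+n⇒n<m (begin-strict
    2 * weight a           <⟨ s≤s⁻¹ (≤-trans (m<n⇒2+2*m≤2*n w<k) (≤-reflexive (sym (holes-weight c∈)))) ⟩
    weight c               ≤⟨ weight≤hamming+weight a c ⟩
    hamming a c + weight a ∎))
    where
    w<k : weight a < k
    w<k = subst (weight a <_) threshold (TH≡false⇒ a maj)

MAJ-even-BNN : ∀ k → ∃[ m ] (HasBNNRep (MAJ (2 * k)) m × m ≤ k + 2)
MAJ-even-BNN zero = 1 , ([ [] ] , [] , trivial-rep , refl) , s≤s z≤n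
  where
  trivial-rep : IsNNRepOver embed (MAJ 0) [ [] ] []
  trivial-rep = isHammingRep⇒isNNRep (All.[] ∷ []) [] ((λ { [] _ → [] , here refl , λ _ () }) , λ { [] () })
MAJ-even-BNN (suc j) = suc (suc j) + 1 ,
  (_ , _ , MAJ-even-rep j , cong (_+ 1) (holes-length (2+j≤2*[1+j] j))) , ≤-reflexive (sym (+-suc (suc j) 1))

-- Boolean representations of TH_n^t

flip-agrees : {A B : List (Cube n)} {x y : Cube n} {i : Fin n} {u : Bool} →
  x [ i ]= u → y ∈ A → Closer x y B → HasCloser (x [ i ]≔ not u) B A → y [ i ]= u
flip-agrees {x = x} {y} {i} {u} x[i]=u y∈A y-closer (z , z∈B , z-closer) with []=-dichotomy y i u
... | inj₁ y[i]=u = y[i]=u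
... | inj₂ y[i]=¬u = ⊥-elim (<-irrefl refl (begin-strict
  hamming x y                      <⟨ y-closer z z∈B ⟩
  hamming x z                      ≤⟨ hamming-update-≤ x i (not u) z ⟩
  suc (hamming (x [ i ]≔ not u) z) ≤⟨ z-closer y y∈A ⟩
  hamming (x [ i ]≔ not u) y       <⟨ n<1+n _ ⟩
  suc (hamming (x [ i ]≔ not u) y) ≡⟨ hamming-update-agree x[i]=u y[i]=¬u ⟩
  hamming x y                      ∎))
  where open ≤-Reasoning

module _ {t : ℕ} {P N : List (Cube n)} (rep : IsHammingRep (TH n t) P N) where

  nearest-positive-⊇ : ∀ (a : Cube n) {b} → weight a ≡ t → b ∈ P → Closer a b N → a ⊆ b
  nearest-positive-⊇ a wa b∈P b-closer {i} i∈a = flip-agrees i∈a b∈P b-closer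
    (proj₂ rep (a [ i ]≔ false) (<⇒TH≡false (a [ i ]≔ false) (≤-reflexive (trans (weight-clear i∈a) wa))))

  nearest-negative-⊆ : ∀ (a : Cube n) {c} → suc (weight a) ≡ t → c ∈ N → Closer a c P → c ⊆ a
  nearest-negative-⊆ a wa c∈N c-closer {j} j∈c with []=-dichotomy a j true
  ... | inj₁ j∈a = j∈a
  ... | inj₂ a[j]=0 = ⊥-elim (true≢false ([]=-injective j∈c (flip-agrees a[j]=0 c∈N c-closer
          (proj₁ rep (a [ j ]≔ true)
                     (≤⇒TH≡true (a [ j ]≔ true) (≤-reflexive (sym (trans (weight-set a[j]=0) wa))))))))

  positive-superset : 1 ≤ t → (a : Cube n) → weight a ≡ t → ∃[ b ] (b ∈ P × a ⊆ b × weight b ≤ t + t)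
  positive-superset t≥1 a wa with proj₁ rep a (≤⇒TH≡true a (≤-reflexive (sym wa)))
                                | weight>0⇒nonempty a (subst (1 ≤_) (sym wa) t≥1)
  ... | b , b∈P , b-closer | i , i∈a
    with proj₂ rep (a [ i ]≔ false) (<⇒TH≡false (a [ i ]≔ false) (≤-reflexive (trans (weight-clear i∈a) wa)))
  ...   | c , c∈N , c-closer = b , b∈P , nearest-positive-⊇ a wa b∈P b-closer , (begin
    weight b               ≤⟨ weight≤hamming+weight a b ⟩
    hamming a b + weight a ≤⟨ +-mono-≤ (<⇒≤ hamming-a-b<t) (≤-reflexive wa) ⟩
    t + t                  ∎)
    where
    open ≤-Reasoning
    w' : suc (weight (a [ i ]≔ false)) ≡ t
    w' = trans (weight-clear i∈a) wa
    hamming-a-b<t : hamming a b < t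
    hamming-a-b<t = begin-strict
      hamming a b                      <⟨ b-closer c c∈N ⟩
      hamming a c                      ≤⟨ hamming-update-≤ a i false c ⟩
      suc (hamming (a [ i ]≔ false) c) ≤⟨ s≤s (⊆⇒hamming≤weight (a [ i ]≔ false)
                                             (nearest-negative-⊆ (a [ i ]≔ false) w' c∈N c-closer)) ⟩
      suc (weight (a [ i ]≔ false))    ≡⟨ w' ⟩
      t                                ∎

covered : Cube n → List (Cube n) → ℕ
covered b xs = length (filter (_⊆? b) xs)

covered-++ : (b : Cube n) (xs ys : List (Cube n)) → covered b (xs ++ ys) ≡ covered b xs + covered b ys
covered-++ b xs ys = trans (cong length (filter-++ (_⊆? b) xs ys)) (length-++ (filter (_⊆? b) xs))

⊆?-++ : ∀ {k} (c d : Cube k) (x y : Cube n) → does ((c Vec.++ x) ⊆? (d Vec.++ y)) ≡ does (c ⊆? d) ∧ does (x ⊆? y)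
⊆?-++ [] [] x y = refl
⊆?-++ (false ∷ c) (_ ∷ d) x y = ⊆?-++ c d x y
⊆?-++ (true ∷ c) (false ∷ d) x y = refl
⊆?-++ (true ∷ c) (true ∷ d) x y = ⊆?-++ c d x y

covered-map-++ : ∀ {k} (c d : Cube k) (b : Cube n) xs →
                 covered (d Vec.++ b) (map (c Vec.++_) xs) ≡ (if does (c ⊆? d) then covered b xs else 0)
covered-map-++ c d b [] with does (c ⊆? d)
... | true = refl
... | false = refl
covered-map-++ c d b (x ∷ xs)
  with does (c ⊆? d) | does (x ⊆? b) | does ((c Vec.++ x) ⊆? (d Vec.++ b)) | ⊆?-++ c d x b | covered-map-++ c d b xs
... | true  | true  | _ | refl | ih = cong suc ih
... | true  | false | _ | refl | ih = ih
... | false | _     | _ | refl | ih = ih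

covered-product : ∀ {k} (d : Cube k) (b : Cube n) (cs : List (Cube k)) xs →
  covered (d Vec.++ b) (concatMap (λ c → map (c Vec.++_) xs) cs) ≡ covered d cs * covered b xs
covered-product d b [] xs = refl
covered-product d b (c ∷ cs) xs
  rewrite covered-++ (d Vec.++ b) (map (c Vec.++_) xs) (concatMap (λ c → map (c Vec.++_) xs) cs)
        | covered-map-++ c d b xs | covered-product d b cs xs
  with does (c ⊆? d)
... | true = refl
... | false = refl

length-concatMap-map : ∀ {k} (cs : List (Cube k)) (xs : List (Cube n)) →
                       length (concatMap (λ c → map (c Vec.++_) xs) cs) ≡ length cs * length xs
length-concatMap-map [] xs = refl
length-concatMap-map (c ∷ cs) xs =
  trans (length-++ (map (c Vec.++_) xs)) (cong₂ _+_ (length-map (c Vec.++_) xs) (length-concatMap-map cs xs))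

blocks : List (Cube 3)
blocks = (true ∷ false ∷ false ∷ []) ∷ (false ∷ true ∷ false ∷ []) ∷ (false ∷ false ∷ true ∷ []) ∷ []

family : ∀ t r → List (Cube (t * 3 + r))
family zero r = [ zeros r ]
family (suc t) r = concatMap (λ c → map (c Vec.++_) (family t r)) blocks

length-family : ∀ t r → length (family t r) ≡ 3 ^ t
length-family zero r = refl
length-family (suc t) r = trans (length-concatMap-map blocks (family t r)) (cong (3 *_) (length-family t r))

family-weight : ∀ t r → All (λ a → weight a ≡ t) (family t r)
family-weight zero r = weight-zeros r ∷ []
family-weight (suc t) r = All.concat⁺ (All.map⁺ (All.map (λ {c} → block-weight {c}) (refl ∷ refl ∷ refl ∷ [])))
  where
  block-weight : ∀ {c : Cube 3} → weight c ≡ 1 → All (λ a → weight a ≡ suc t) (map (c Vec.++_) (family t r))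
  block-weight {c} wc = All.map⁺ (All.map (λ {a} wa → trans (weight-++ c a) (cong₂ _+_ wc wa)) (family-weight t r))

block-bound : (d : Cube 3) → covered d blocks * 2 ≤ 2 ^ weight d
block-bound (false ∷ false ∷ false ∷ []) = ≤ᵇ⇒≤ _ _ _
block-bound (false ∷ false ∷ true ∷ []) = ≤ᵇ⇒≤ _ _ _
block-bound (false ∷ true ∷ false ∷ []) = ≤ᵇ⇒≤ _ _ _
block-bound (false ∷ true ∷ true ∷ []) = ≤ᵇ⇒≤ _ _ _
block-bound (true ∷ false ∷ false ∷ []) = ≤ᵇ⇒≤ _ _ _
block-bound (true ∷ false ∷ true ∷ []) = ≤ᵇ⇒≤ _ _ _
block-bound (true ∷ true ∷ false ∷ []) = ≤ᵇ⇒≤ _ _ _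
block-bound (true ∷ true ∷ true ∷ []) = ≤ᵇ⇒≤ _ _ _

covered-family : ∀ t r (b : Cube (t * 3 + r)) → covered b (family t r) * 2 ^ t ≤ 2 ^ weight b
covered-family zero r b = begin
  covered b [ zeros r ] * 1 ≡⟨ *-identityʳ _ ⟩
  covered b [ zeros r ]     ≤⟨ length-filter (_⊆? b) [ zeros r ] ⟩
  1                         ≤⟨ m^n>0 2 (weight b) ⟩
  2 ^ weight b              ∎
  where open ≤-Reasoning
covered-family (suc t) r (x ∷ y ∷ z ∷ b) = begin
  covered (d Vec.++ b) (family (suc t) r) * 2 ^ suc t       ≡⟨ cong (_* 2 ^ suc t) (covered-product d b blocks (family t r)) ⟩
  covered d blocks * covered b (family t r) * (2 * 2 ^ t)    ≡⟨ solve 3 (λ k m p → k :* m :* (con 2 :* p) := k :* con 2 :* (m :* p))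
                                                                  refl (covered d blocks) (covered b (family t r)) (2 ^ t) ⟩
  covered d blocks * 2 * (covered b (family t r) * 2 ^ t)    ≤⟨ *-mono-≤ (block-bound d) (covered-family t r b) ⟩
  2 ^ weight d * 2 ^ weight b                                ≡⟨ ^-distribˡ-+-* 2 (weight d) (weight b) ⟨
  2 ^ (weight d + weight b)                                  ≡⟨ cong (2 ^_) (weight-++ d b) ⟨
  2 ^ weight (d Vec.++ b)                                    ∎
  where
  open ≤-Reasoning
  open ℕ-Solver.+-*-Solver
  d = x ∷ y ∷ z ∷ []

module _ {A : Set} {P : A → Set} (P? : Decidable P) where

  length-filter-∷-≤ : ∀ x xs → length (filter P? xs) ≤ length (filter P? (x ∷ xs))
  length-filter-∷-≤ x xs with does (P? x)
  ... | true = n≤1+n _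
  ... | false = ≤-refl

  length-filter-∷-< : ∀ {x} xs → P x → length (filter P? xs) < length (filter P? (x ∷ xs))
  length-filter-∷-< xs px = ≤-reflexive (cong length (sym (filter-accept P? px)))

module _ {B : Set} where

  sum-map-≤ : {f g : B → ℕ} → (∀ b → f b ≤ g b) → ∀ bs → sum (map f bs) ≤ sum (map g bs)
  sum-map-≤ f≤g [] = z≤n
  sum-map-≤ f≤g (b ∷ bs) = +-mono-≤ (f≤g b) (sum-map-≤ f≤g bs)

  sum-map-< : {f g : B → ℕ} → (∀ b → f b ≤ g b) → ∀ {bs} → Any (λ b → f b < g b) bs →
              sum (map f bs) < sum (map g bs)
  sum-map-< f≤g {b ∷ bs} (here fb<gb) = +-mono-<-≤ fb<gb (sum-map-≤ f≤g bs)
  sum-map-< f≤g {b ∷ bs} (there any) = +-mono-≤-< (f≤g b) (sum-map-< f≤g any)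

  sum-map-≤-length* : {f : B → ℕ} {m : ℕ} → ∀ {bs} → All (λ b → f b ≤ m) bs → sum (map f bs) ≤ length bs * m
  sum-map-≤-length* [] = z≤n
  sum-map-≤-length* (fb≤m ∷ rest) = +-mono-≤ fb≤m (sum-map-≤-length* rest)

length≤∑count : {A B : Set} {R : B → A → Set} (R? : ∀ b → Decidable (R b)) (bs : List B) {xs : List A} →
                All (λ x → Any (λ b → R b x) bs) xs → length xs ≤ sum (map (λ b → length (filter (R? b) xs)) bs)
length≤∑count R? bs [] = z≤n
length≤∑count R? bs {x ∷ xs} (x-covered ∷ rest) =
  ≤-trans (s≤s (length≤∑count R? bs rest))
          (sum-map-< (λ b → length-filter-∷-≤ (R? b) x xs)
                     (Any.map (λ {b} Rbx → length-filter-∷-< (R? b) xs Rbx) x-covered))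

TH-BNN-size-bound : ∀ t r {m} → 1 ≤ t → HasBNNRep (TH (t * 3 + r) t) m → 3 ^ t ≤ m * 2 ^ t
TH-BNN-size-bound t r {m} t≥1 (P , N , rep , size) = begin
  3 ^ t                                ≡⟨ length-family t r ⟨
  length F                             ≤⟨ length≤∑count (λ b → _⊆? b) light covering ⟩
  sum (map (λ b → covered b F) light)  ≤⟨ sum-map-≤-length* (All.tabulate covered≤2^t) ⟩
  length light * 2 ^ t                 ≤⟨ *-monoˡ-≤ (2 ^ t) (length-filter light? P) ⟩
  length P * 2 ^ t                     ≤⟨ *-monoˡ-≤ (2 ^ t) (≤-trans (m≤m+n (length P) (length N))
                                                                   (≤-reflexive size)) ⟩
  m * 2 ^ t                            ∎
  where
  open ≤-Reasoning
  F = family t r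
  light? = λ (b : Cube (t * 3 + r)) → weight b ≤? t + t
  light = filter light? P
  covering : All (λ a → Any (a ⊆_) light) F
  covering = All.map (λ {a} wa → let (b , b∈P , a⊆b , wb) = positive-superset (isNNRep⇒isHammingRep rep) t≥1 a wa
                                 in lose (∈-filter⁺ light? b∈P wb) (λ {i} → a⊆b {i}))
                     (family-weight t r)
  covered≤2^t : ∀ {b} → b ∈ light → covered b F ≤ 2 ^ t
  covered≤2^t {b} b∈light = *-cancelʳ-≤ (covered b F) (2 ^ t) (2 ^ t) {{m^n≢0 2 t}} (begin
    covered b F * 2 ^ t ≤⟨ covered-family t r b ⟩
    2 ^ weight b        ≤⟨ ^-monoʳ-≤ 2 (proj₂ (∈-filter⁻ light? {xs = P} b∈light)) ⟩
    2 ^ (t + t)         ≡⟨ ^-distribˡ-+-* 2 t t ⟩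
    2 ^ t * 2 ^ t       ∎)

^-distribʳ-* : ∀ m k e → (m * k) ^ e ≡ m ^ e * k ^ e
^-distribʳ-* m k zero = refl
^-distribʳ-* m k (suc e) = trans (cong (m * k *_) (^-distribʳ-* m k e))
  (solve 4 (λ m k x y → m :* k :* (x :* y) := m :* x :* (k :* y)) refl m k (m ^ e) (k ^ e))
  where open ℕ-Solver.+-*-Solver

exponential-bound : ∀ {n t m} → 1 ≤ t → n ≤ t * 3 + 2 → 3 ^ t ≤ m * 2 ^ t → 2 ^ n ≤ m ^ 12
exponential-bound {n} {t} {m} t≥1 n≤ 3^t≤ = *-cancelʳ-≤ (2 ^ n) (m ^ 12) (2 ^ (t * 12)) {{m^n≢0 2 (t * 12)}} (begin
  2 ^ n * 2 ^ (t * 12)   ≡⟨ ^-distribˡ-+-* 2 n (t * 12) ⟨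
  2 ^ (n + t * 12)       ≤⟨ ^-monoʳ-≤ 2 exponent ⟩
  2 ^ (17 * t)           ≡⟨ ^-*-assoc 2 17 t ⟨
  (2 ^ 17) ^ t           ≤⟨ ^-monoˡ-≤ t (≤ᵇ⇒≤ (2 ^ 17) (3 ^ 12) _) ⟩
  (3 ^ 12) ^ t           ≡⟨ trans (^-*-assoc 3 12 t) (trans (cong (3 ^_) (*-comm 12 t)) (sym (^-*-assoc 3 t 12))) ⟩
  (3 ^ t) ^ 12           ≤⟨ ^-monoˡ-≤ 12 3^t≤ ⟩
  (m * 2 ^ t) ^ 12       ≡⟨ ^-distribʳ-* m (2 ^ t) 12 ⟩
  m ^ 12 * (2 ^ t) ^ 12  ≡⟨ cong (m ^ 12 *_) (^-*-assoc 2 t 12) ⟩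
  m ^ 12 * 2 ^ (t * 12)  ∎)
  where
  open ≤-Reasoning
  open ℕ-Solver.+-*-Solver
  exponent : n + t * 12 ≤ 17 * t
  exponent = begin
    n + t * 12             ≤⟨ +-monoˡ-≤ (t * 12) (≤-trans n≤ (+-monoʳ-≤ (t * 3) (*-monoˡ-≤ 2 t≥1))) ⟩
    t * 3 + t * 2 + t * 12 ≡⟨ solve 1 (λ t → t :* con 3 :+ t :* con 2 :+ t :* con 12 := con 17 :* t) refl t ⟩
    17 * t                 ∎

TH-BNN-exponential : ∀ n → 3 ≤ n → ∀ m → HasBNNRep (TH n (n / 3)) m → 2 ^ n ≤ m ^ 12
TH-BNN-exponential n n≥3 m rep =
  exponential-bound {m = m} t≥1 n≤ (TH-BNN-size-bound t (n % 3) t≥1 (subst (λ k → HasBNNRep (TH k t) m) n≡ rep))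
  where
  t = n / 3
  t≥1 : 1 ≤ t
  t≥1 = m≥n⇒m/n>0 n≥3
  n≡ : n ≡ t * 3 + n % 3
  n≡ = trans (m≡m%n+[m/n]*n n 3) (+-comm (n % 3) (t * 3))
  n≤ : n ≤ t * 3 + 2
  n≤ = ≤-trans (≤-reflexive n≡) (+-monoʳ-≤ (t * 3) (s≤s⁻¹ (m%n<n n 3)))

theorem2 :
    -- (a)
    (∀ n (f : BoolFn n) → IsThreshold f → NonConstant f → NNis f 2)
    ×
    -- (b)
    ((∀ k → BNNis (MAJ (suc (2 * k))) 2)
      × (∀ k → ∃[ m ] (HasBNNRep (MAJ (2 * k)) m × m ≤ k + 2)))
    ×
    -- (c) BNN(TH_n^{⌊n/3⌋}) ≥ 2^{n/c} for all large n, i.e. BNN^c ≥ 2^n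
    (∃[ c ] ∃[ n₀ ] (1 ≤ c × (∀ n → n₀ ≤ n → ∀ m → HasBNNRep (TH n (n / 3)) m → 2 ^ n ≤ m ^ c)))
theorem2 =
  (λ n f → threshold-NN) ,
  (MAJ-odd-BNN , MAJ-even-BNN) ,
  (12 , 3 , s≤s z≤n , TH-BNN-exponential)
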